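{- Let $N\ge2$ and let $\mathcal M$ be a minion in which every element has at most $N$ essential coordinates. Then the minion homomorphism $\eta_N:\mathcal M\to\mathcal O(N,\mathcal M\otimes N)$, $f\mapsto(\underline x\mapsto[f,\underline x])$, is injective.
   Context: Write $n=\{0,\dots,n-1\}$ (so $N$ also denotes the set $\{0,\dots,N-1\}$). A minion $\mathcal M$ consists of sets $\mathcal M_n$ ($n\ge1$) and, for each map $\alpha:n\to k$, a map $f\mapsto f\alpha$, $\mathcal M_n\to\mathcal M_k$, with $f\,\mathrm{id}_n=f$ and $(f\alpha)\beta=f(\beta\circ\alpha)$. For sets $X,Y$, $\mathcal O(X,Y)_n$ is the set of functions $X^n\to Y$ with $(f\alpha)(x_0,\dots,x_{k-1})=f(x_{\alpha(0)},\dots,x_{\alpha(n-1)})$. $\mathcal M\otimes X$ is the quotient of $\coprod_{n}\mathcal M_n\times X^n$ by the smallest equivalence relation with $(f\alpha,\underline x)\sim(f,\underline x\circ\alpha)$ for $f\in\mathcal M_n$, $\alpha:n\to k$, $\underline x\in X^k$; $[f,\underline x]$ is the class. For $f\in\mathcal M_n$, a coordinate $i\in n$ is inessential if $f\iota=f\gamma_i$, where $\iota:n\to n+1$ is the inclusion and $\gamma_i:n\to n+1$ maps $i\mapsto n$ and fixes the others; otherwise essential. -}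

module Defs where

open import Data.Nat using (ℕ; zero; suc; _≤_)
open import Data.Fin using (Fin; zero; suc; inject₁; fromℕ)
open import Data.Product using (Σ; _×_; _,_)
open import Relation.Binary.PropositionalEquality using (_≡_; _≢_)
open import Relation.Nullary using (¬_)
open import Function using (_∘_; id)
open import Function.Definitions using (Injective)

-- Arities are positive: (Ar n) = Fin (suc n) is the set {0,…,n}, of size n+1.
Ar : ℕ → Set
Ar n = Fin (suc n)

-- A minion.  (El n) is the set M_{n+1} of elements of arity n+1 ≥ 1;
-- for α : (n+1) → (k+1) the minor map is  f ↦ f · α.
record Minion : Set₁ where
  field
    El       : ℕ → Set
    _·_      : ∀ {n k} → El n → (Ar n → Ar k) → El k
    ·-id     : ∀ {n} (f : El n) → f · id ≡ f
    ·-comp   : ∀ {n k l} (f : El n) (α : Ar n → Ar k) (β : Ar k → Ar l) →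
               (f · α) · β ≡ f · (β ∘ α)
    -- minor maps only depend on α as a function (automatic in set theory;
    -- needed here since Agda has no function extensionality)
    ·-cong   : ∀ {n k} (f : El n) {α β : Ar n → Ar k} →
               (∀ i → α i ≡ β i) → f · α ≡ f · β

module _ (M : Minion) where
  open Minion M

  ι : ∀ {n} → Ar n → Ar (suc n)
  ι = inject₁

  γ : ∀ {n} → Ar n → Ar n → Ar (suc n)
  γ {n} i j with i Data.Fin.≟ j
  ... | Relation.Nullary.yes _ = fromℕ (suc n)
  ... | Relation.Nullary.no  _ = inject₁ j

  Inessential : ∀ {n} → El n → Ar n → Set
  Inessential f i = f · ι ≡ f · γ i

  Essential : ∀ {n} → El n → Ar n → Set
  Essential f i = ¬ Inessential f i

  -- "f has at most N essential coordinates": the essential coordinates are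
  -- contained in a set S = image of an injection e : m → arity with m ≤ N,
  -- i.e. every coordinate outside S is inessential.
  AtMostEssential : ℕ → ∀ {n} → El n → Set
  AtMostEssential N {n} f =
    Σ ℕ λ m → m ≤ N × Σ (Fin m → Ar n) λ e → Injective _≡_ _≡_ e ×
      (∀ i → (∀ j → e j ≢ i) → Inessential f i)

  -- Underlying set of ∐_n M_n × X^n  (here X = Fin N)
  Pre : ℕ → Set
  Pre N = Σ ℕ λ n → El n × (Ar n → Fin N)

  -- The smallest equivalence relation on Pre N with
  -- (f·α, x) ∼ (f, x∘α)  (tuples compared pointwise).
  -- Its classes are the elements [f, x] of M ⊗ N.
  data _∼_ {N : ℕ} : Pre N → Pre N → Set where
    gen  : ∀ {n k} (f : El n) (α : Ar n → Ar k) (x : Ar k → Fin N)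
             (y : Ar n → Fin N) → (∀ i → y i ≡ x (α i)) →
             (k , f · α , x) ∼ (n , f , y)
    ∼refl  : ∀ {p} → p ∼ p
    ∼sym   : ∀ {p q} → p ∼ q → q ∼ p
    ∼trans : ∀ {p q r} → p ∼ q → q ∼ r → p ∼ r

  -- η_N is injective: η_N(f) = η_N(g) in O(N, M⊗N) (i.e. [f,x] = [g,x]
  -- for all x ∈ N^n) implies f = g.
  EtaInjective : ℕ → Set
  EtaInjective N = ∀ {n} (f g : El n) →
    (∀ (x : Ar n → Fin N) → (n , f , x) ∼ (n , g , x)) → f ≡ g

{-# OPTIONS --safe #-}
-- Evaluating [h, x] ↦ h · x is well defined on M ⊗ N, so η_N f = η_N g says that f and g
-- have the same minors f · x = g · x of arity N.  An element only depends on its at most N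
-- essential coordinates, so f and g are each recovered from a minor that retracts onto their
-- supports S₁, S₂ through arity N.  If S₁ and S₂ meet in a point c, both retractions can
-- send everything else to c and the two recovered elements can be compared via their
-- composite.  If S₁ and S₂ are disjoint, f and g both equal constant minors, which are
-- compared through the two-valued minor that separates S₁ from S₂ (this needs N ≥ 2).
module Submission where

open import Defs
open import Data.Nat using (ℕ; zero; suc; _≤_; _<?_; s≤s; z≤n)
open import Data.Fin using (Fin; zero; suc; toℕ; fromℕ; fromℕ<; inject₁; inject≤; punchIn)
open import Data.Fin.Properties using (_≟_; any?; toℕ-injective; toℕ-fromℕ<; toℕ-inject≤; toℕ<n)
open import Data.Vec.Functional using (updateAt; insertAt)
open import Data.Vec.Functional.Properties
  using (updateAt-updates; updateAt-minimal; updateAt-id-local; insertAt-lookup; insertAt-punchIn)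
open import Data.List using (List; []; _∷_; allFin)
open import Data.List.Membership.Propositional using (_∈_)
open import Data.List.Membership.Propositional.Properties using (∈-allFin)
open import Data.List.Relation.Unary.Any using (here; there)
open import Data.Product using (Σ; ∃; _,_; proj₂)
open import Relation.Binary.PropositionalEquality
open import Relation.Nullary using (¬_; yes; no; contradiction)
open import Relation.Unary using (Decidable)
open import Function using (_∘_; id; const)

private
  variable
    A : Set
    m n k K : ℕ

punchIn-fromℕ : (j : Fin n) → punchIn (fromℕ n) j ≡ inject₁ j
punchIn-fromℕ zero = refl
punchIn-fromℕ (suc j) = cong suc (punchIn-fromℕ j)

insertAt-last-inject₁ : (ρ : Fin n → A) (v : A) (j : Fin n) → insertAt ρ (fromℕ n) v (inject₁ j) ≡ ρ j
insertAt-last-inject₁ ρ v j =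
  trans (cong (insertAt ρ (fromℕ _) v) (sym (punchIn-fromℕ j))) (insertAt-punchIn ρ (fromℕ _) v j)

pad : m ≤ n → (Fin m → A) → A → Fin n → A
pad {m} _ e a t with toℕ t <? m
... | yes t<m = e (fromℕ< t<m)
... | no _ = a

pad-inject≤ : (m≤n : m ≤ n) (e : Fin m → A) (a : A) (j : Fin m) → pad m≤n e a (inject≤ j m≤n) ≡ e j
pad-inject≤ {m} m≤n e a j with toℕ (inject≤ j m≤n) <? m
... | yes j<m = cong e (toℕ-injective (trans (toℕ-fromℕ< j<m) (toℕ-inject≤ j m≤n)))
... | no j≮m = contradiction (subst (λ l → suc l ≤ m) (sym (toℕ-inject≤ j m≤n)) (toℕ<n j)) j≮m

overwrite : (σ τ : Fin n → A) → List (Fin n) → Fin n → A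
overwrite σ τ [] = σ
overwrite σ τ (i ∷ is) = updateAt (overwrite σ τ is) i (const (τ i))

overwrite-∈ : (σ τ : Fin n → A) {i : Fin n} {is : List (Fin n)} → i ∈ is → overwrite σ τ is i ≡ τ i
overwrite-∈ σ τ {i} {_ ∷ is} (here refl) = updateAt-updates i (overwrite σ τ is)
overwrite-∈ σ τ {i} (there {j} {is} i∈is) with j ≟ i
... | yes refl = updateAt-updates i (overwrite σ τ is)
... | no j≢i = trans (updateAt-minimal i j (overwrite σ τ is) (j≢i ∘ sym)) (overwrite-∈ σ τ i∈is)

overwrite-agree : (σ τ : Fin n → A) {i : Fin n} (is : List (Fin n)) → σ i ≡ τ i → overwrite σ τ is i ≡ τ i
overwrite-agree σ τ [] σi≡τi = σi≡τi
overwrite-agree σ τ {i} (j ∷ is) σi≡τi with j ≟ i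
... | yes refl = updateAt-updates i (overwrite σ τ is)
... | no j≢i = trans (updateAt-minimal i j (overwrite σ τ is) (j≢i ∘ sym)) (overwrite-agree σ τ is σi≡τi)

Image : (Fin m → Fin n) → Fin n → Set
Image e i = ∃ λ t → e t ≡ i

image? : (e : Fin m → Fin n) → Decidable (Image e)
image? e i = any? (λ t → e t ≟ i)

Disjoint : (Fin m → Fin n) → (Fin k → Fin n) → Set
Disjoint e₁ e₂ = ∀ t₁ t₂ → e₁ t₁ ≢ e₂ t₂

disjoint-sym : {e₁ : Fin m → Fin n} {e₂ : Fin k → Fin n} → Disjoint e₁ e₂ → Disjoint e₂ e₁
disjoint-sym disjoint t₂ t₁ = disjoint t₁ t₂ ∘ sym

preimage : (Fin m → Fin n) → Fin m → Fin n → Fin m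
preimage e t₀ i with image? e i
... | yes (t , _) = t
... | no _ = t₀

retract : (Fin m → Fin n) → Fin m → Fin n → Fin n
retract e t₀ = e ∘ preimage e t₀

retract-image : (e : Fin m → Fin n) {t₀ : Fin m} {i : Fin n} → Image e i → retract e t₀ i ≡ i
retract-image e {i = i} i∈e with image? e i
... | yes (_ , et≡i) = et≡i
... | no i∉e = contradiction i∈e i∉e

retract-outside : (e : Fin m → Fin n) {t₀ : Fin m} {i : Fin n} → ¬ Image e i → retract e t₀ i ≡ e t₀
retract-outside e {i = i} i∉e with image? e i
... | yes i∈e = contradiction i∈e i∉e
... | no _ = refl

retract-closed : (e : Fin m → Fin n) {t₀ : Fin m} (P : Fin n → Set) → P (e t₀) →
                 ∀ {i} → P i → P (retract e t₀ i)
retract-closed e P Pet₀ {i} Pi with image? e i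
... | yes (_ , et≡i) = subst P (sym et≡i) Pi
... | no _ = Pet₀

indicator : (Fin m → Fin n) → Fin n → Fin (suc (suc K))
indicator e i with image? e i
... | yes _ = zero
... | no _ = suc zero

indicator-image : (e : Fin m → Fin n) {i : Fin n} → Image e i → indicator {K = K} e i ≡ zero
indicator-image e {i} i∈e with image? e i
... | yes _ = refl
... | no i∉e = contradiction i∈e i∉e

indicator-outside : (e : Fin m → Fin n) {i : Fin n} → ¬ Image e i → indicator {K = K} e i ≡ suc zero
indicator-outside e {i} i∉e with image? e i
... | yes i∈e = contradiction i∈e i∉e
... | no _ = refl

module Minors (M : Minion) where
  open Minion M
  open ≡-Reasoning

  Supported : El n → (Ar n → Set) → Set
  Supported {n} f S = ∀ {k} (ρ τ : Ar n → Ar k) → (∀ i → S i → ρ i ≡ τ i) → f · ρ ≡ f · τ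

  MinorsAgree : ℕ → El n → El n → Set
  MinorsAgree {n} K f g = (x : Ar n → Ar K) → f · x ≡ g · x

  inessential-update : {f : El n} {i : Ar n} → Inessential M f i →
                       (ρ : Ar n → Ar k) (v : Ar k) → f · ρ ≡ f · updateAt ρ i (const v)
  inessential-update {f = f} {i} f·ι≡f·γi ρ v = begin
    f · ρ                        ≡⟨ ·-cong f (insertAt-last-inject₁ ρ v) ⟨
    f · (β ∘ ι M)                ≡⟨ ·-comp f (ι M) β ⟨
    (f · ι M) · β                ≡⟨ cong (_· β) f·ι≡f·γi ⟩
    (f · γ M i) · β              ≡⟨ ·-comp f (γ M i) β ⟩
    f · (β ∘ γ M i)              ≡⟨ ·-cong f β∘γ≗update ⟩
    f · updateAt ρ i (const v)   ∎
    where
      β = insertAt ρ (fromℕ _) v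
      β∘γ≗update : ∀ j → β (γ M i j) ≡ updateAt ρ i (const v) j
      β∘γ≗update j with i ≟ j
      ... | yes refl = trans (insertAt-lookup ρ (fromℕ _) v) (sym (updateAt-updates i ρ))
      ... | no i≢j = trans (insertAt-last-inject₁ ρ v j) (sym (updateAt-minimal j i ρ (i≢j ∘ sym)))

  supported : {f : El n} {S : Ar n → Set} → (∀ i → ¬ S i → Inessential M f i) → Supported f S
  supported {n} {f} {S} ess {k} ρ τ ρ≈τ = begin
    f · ρ                           ≡⟨ overwrite-invariant (allFin _) ⟩
    f · overwrite ρ τ (allFin _)    ≡⟨ ·-cong f (λ i → overwrite-∈ ρ τ (∈-allFin i)) ⟩
    f · τ                           ∎
    where
      update-invariant : (σ : Ar n → Ar k) (i : Ar n) → (S i → σ i ≡ τ i) →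
                         f · σ ≡ f · updateAt σ i (const (τ i))
      update-invariant σ i agree with σ i ≟ τ i
      ... | yes σi≡τi = ·-cong f (λ j → sym (updateAt-id-local i σ (sym σi≡τi) j))
      ... | no σi≢τi = inessential-update {i = i} (ess i (σi≢τi ∘ agree)) σ (τ i)

      overwrite-invariant : (is : List (Ar n)) → f · ρ ≡ f · overwrite ρ τ is
      overwrite-invariant [] = refl
      overwrite-invariant (i ∷ is) =
        trans (overwrite-invariant is)
              (update-invariant _ i (λ Si → overwrite-agree ρ τ is (ρ≈τ i Si)))

  supported-fixed : {f : El n} {S : Ar n → Set} → Supported f S →
                    (ρ : Ar n → Ar n) → (∀ i → S i → ρ i ≡ i) → f ≡ f · ρ
  supported-fixed {f = f} supp ρ fixes = trans (sym (·-id f)) (supp id ρ (λ i Si → sym (fixes i Si)))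

  -- Listing the support as exactly N coordinates, repetitions allowed, makes every support
  -- nonempty and every retraction onto it a minor through arity N.
  padded-support : {f : El n} → AtMostEssential M (suc K) f → Σ (Ar K → Ar n) λ e → Supported f (Image e)
  padded-support (m , m≤ , e , _ , ess) =
    e′ , supported (λ i i∉e′ → ess i (λ j ej≡i → i∉e′ (inject≤ j m≤ , trans (pad-inject≤ m≤ e zero j) ej≡i)))
    where
      e′ = pad m≤ e zero

  evaluate : Pre M (suc K) → El K
  evaluate (_ , f , x) = f · x

  evaluate-cong : {p q : Pre M (suc K)} → _∼_ M p q → evaluate p ≡ evaluate q
  evaluate-cong (gen f α x y y≡x∘α) = trans (·-comp f α x) (·-cong f (λ i → sym (y≡x∘α i)))
  evaluate-cong ∼refl = refl
  evaluate-cong (∼sym p∼q) = sym (evaluate-cong p∼q)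
  evaluate-cong (∼trans p∼q q∼r) = trans (evaluate-cong p∼q) (evaluate-cong q∼r)

  minors-agree-sym : {f g : El n} → MinorsAgree K f g → MinorsAgree K g f
  minors-agree-sym agree x = sym (agree x)

  minors-agree-∘ : {f g : El n} → MinorsAgree K f g → (x : Ar n → Ar K) (y : Ar K → Ar k) → f · (y ∘ x) ≡ g · (y ∘ x)
  minors-agree-∘ {f = f} {g} agree x y = begin
    f · (y ∘ x)   ≡⟨ ·-comp f x y ⟨
    (f · x) · y   ≡⟨ cong (_· y) (agree x) ⟩
    (g · x) · y   ≡⟨ ·-comp g x y ⟩
    g · (y ∘ x)   ∎

  module _ {f g : El n} {e₁ e₂ : Ar K → Ar n}
           (supp₁ : Supported f (Image e₁)) (supp₂ : Supported g (Image e₂))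
           (agree : MinorsAgree K f g) where

    ≡-of-overlapping-supports : ∀ {t₁ t₂} → e₁ t₁ ≡ e₂ t₂ → f ≡ g
    ≡-of-overlapping-supports {t₁} {t₂} e₁t₁≡e₂t₂ = begin
      f               ≡⟨ supported-fixed supp₁ r₁ (λ _ → retract-image e₁) ⟩
      f · r₁          ≡⟨ minors-agree-∘ agree (preimage e₁ t₁) e₁ ⟩
      g · r₁          ≡⟨ supp₂ r₁ (r₁ ∘ r₂) (λ _ i∈e₂ → cong r₁ (sym (retract-image e₂ i∈e₂))) ⟩
      g · (r₁ ∘ r₂)   ≡⟨ minors-agree-∘ agree (preimage e₁ t₁ ∘ r₂) e₁ ⟨
      f · (r₁ ∘ r₂)   ≡⟨ supp₁ (r₁ ∘ r₂) r₂ (λ _ i∈e₁ → retract-image e₁ (r₂-closed i∈e₁)) ⟩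
      f · r₂          ≡⟨ minors-agree-∘ agree (preimage e₂ t₂) e₂ ⟩
      g · r₂          ≡⟨ supported-fixed supp₂ r₂ (λ _ → retract-image e₂) ⟨
      g               ∎
      where
        r₁ = retract e₁ t₁
        r₂ = retract e₂ t₂
        r₂-closed : ∀ {i} → Image e₁ i → Image e₁ (r₂ i)
        r₂-closed = retract-closed e₂ (Image e₁) (t₁ , e₁t₁≡e₂t₂)

    ≡-constant-of-disjoint-supports : Disjoint e₁ e₂ → f ≡ f · const (e₁ zero)
    ≡-constant-of-disjoint-supports disjoint = begin
      f                    ≡⟨ supported-fixed supp₁ r₁ (λ _ → retract-image e₁) ⟩
      f · r₁               ≡⟨ minors-agree-∘ agree (preimage e₁ zero) e₁ ⟩
      g · r₁               ≡⟨ supp₂ r₁ (const (e₁ zero)) r₁-on-e₂ ⟩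
      g · const (e₁ zero)  ≡⟨ minors-agree-∘ agree (const zero) (const (e₁ zero)) ⟨
      f · const (e₁ zero)  ∎
      where
        r₁ = retract e₁ zero
        r₁-on-e₂ : ∀ i → Image e₂ i → r₁ i ≡ e₁ zero
        r₁-on-e₂ _ (t₂ , refl) = retract-outside e₁ (λ (t₁ , e₁t₁≡e₂t₂) → disjoint t₁ t₂ e₁t₁≡e₂t₂)

  ≡-of-disjoint-supports : {f g : El n} {e₁ e₂ : Ar (suc K) → Ar n} →
                           Supported f (Image e₁) → Supported g (Image e₂) →
                           MinorsAgree (suc K) f g → Disjoint e₁ e₂ → f ≡ g
  ≡-of-disjoint-supports {n} {K} {f} {g} {e₁} {e₂} supp₁ supp₂ agree disjoint = begin
    f                    ≡⟨ ≡-constant-of-disjoint-supports supp₁ supp₂ agree disjoint ⟩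
    f · const (e₁ zero)  ≡⟨ supp₁ _ split (λ _ i∈e₁ → cong two-point (sym (indicator-image e₁ i∈e₁))) ⟩
    f · split            ≡⟨ minors-agree-∘ agree (indicator e₁) two-point ⟩
    g · split            ≡⟨ supp₂ split _ split-on-e₂ ⟩
    g · const (e₂ zero)  ≡⟨ ≡-constant-of-disjoint-supports supp₂ supp₁ (minors-agree-sym agree) (disjoint-sym disjoint) ⟨
    g                    ∎
    where
      two-point : Ar (suc K) → Ar n
      two-point zero = e₁ zero
      two-point (suc _) = e₂ zero
      split = two-point ∘ indicator e₁
      split-on-e₂ : ∀ i → Image e₂ i → split i ≡ e₂ zero
      split-on-e₂ _ (t₂ , refl) =
        cong two-point (indicator-outside e₁ (λ (t₁ , e₁t₁≡e₂t₂) → disjoint t₁ t₂ e₁t₁≡e₂t₂))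

  ≡-of-supports : {f g : El n} {e₁ e₂ : Ar (suc K) → Ar n} →
                  Supported f (Image e₁) → Supported g (Image e₂) →
                  MinorsAgree (suc K) f g → f ≡ g
  ≡-of-supports {e₁ = e₁} {e₂} supp₁ supp₂ agree with any? (λ t₁ → any? (λ t₂ → e₁ t₁ ≟ e₂ t₂))
  ... | yes (_ , _ , e₁t₁≡e₂t₂) = ≡-of-overlapping-supports supp₁ supp₂ agree e₁t₁≡e₂t₂
  ... | no no-overlap = ≡-of-disjoint-supports supp₁ supp₂ agree (λ t₁ t₂ eq → no-overlap (t₁ , t₂ , eq))

proposition3p3p7 : (N : ℕ) → 2 ≤ N → (M : Minion) →
    (∀ {n} (f : Minion.El M n) → AtMostEssential M N f) →
    EtaInjective M N
proposition3p3p7 (suc (suc K)) (s≤s (s≤s z≤n)) M bounded f g η≡ =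
  ≡-of-supports (proj₂ (padded-support (bounded f))) (proj₂ (padded-support (bounded g)))
                (λ x → evaluate-cong (η≡ x))
  where open Minors M
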